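{- Let $G$ be a graph, $O\subseteq V(G)$, $r$ and $m$ non-negative integers with $m\ge 1$, and $\prec$ a linear ordering of $V(G)$. Let $O'$ be the set of all $(r,\prec,m,O)$-rich vertices of $G$. If the weak $r$-coloring number of $(G,\prec)$ is at most $b$, then $|O'|\le \frac{b}{m}|O|$.
   Context: Let $\prec$ be a linear ordering of $V(G)$ and $r\ge 0$ an integer. A vertex $u$ is weakly $(r,\prec)$-reachable from a vertex $v\succeq u$ if there is a path $P$ in $G$ from $v$ to $u$ of length at most $r$ such that all vertices of $V(P)\setminus\{u\}$ are greater than $u$ in $\prec$ (in particular $u$ is weakly reachable from itself). $L_{r,\prec}(v)$ is the set of vertices weakly $(r,\prec)$-reachable from $v$, and $R_{r,\prec}(u)$ is the set of vertices $v$ from which $u$ is weakly $(r,\prec)$-reachable. The weak $r$-coloring number of $(G,\prec)$ is $\max_{v\in V(G)}|L_{r,\prec}(v)|$. For $O\subseteq V(G)$ and an integer $m\ge 0$, a vertex $v$ is $(r,\prec,m,O)$-rich if $|R_{r,\prec}(v)\cap O|\ge m$. -}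

module Defs where

open import Level using (0ℓ)
open import Data.Nat using (ℕ; zero; suc; _≤_; _≥_; _*_)
open import Data.Fin using (Fin)
open import Data.Fin.Subset using (Subset; _∈_)
open import Data.List using (List; []; _∷_; length; head; last)
open import Data.List.Relation.Unary.All using (All)
open import Data.List.Relation.Unary.Unique.Propositional using (Unique)
open import Data.Maybe using (just)
open import Data.Product using (Σ; _×_; ∃)
open import Data.Sum using (_⊎_)
open import Relation.Binary.PropositionalEquality using (_≡_)
open import Relation.Binary.Core using (Rel)
open import Relation.Binary.Definitions using (Symmetric; Irreflexive)
open import Relation.Binary.Structures using (IsStrictTotalOrder)

record Graph (n : ℕ) : Set₁ where
  field
    Adj       : Rel (Fin n) 0ℓ
    Adj-sym   : Symmetric Adj
    Adj-irrefl : Irreflexive _≡_ Adj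
open Graph public

record LinOrder (n : ℕ) : Set₁ where
  field
    _≺_      : Rel (Fin n) 0ℓ
    isSTO    : IsStrictTotalOrder _≡_ _≺_
open LinOrder public

data Chain {n : ℕ} (A : Rel (Fin n) 0ℓ) : List (Fin n) → Set where
  []  : Chain A []
  [-] : ∀ x → Chain A (x ∷ [])
  _∷_ : ∀ {x y xs} → A x y → Chain A (y ∷ xs) → Chain A (x ∷ y ∷ xs)

-- P is a path in G from v to u: a nonempty duplicate-free vertex sequence
-- starting at v, ending at u, consecutive vertices adjacent.
-- Its length (number of edges) is  length P - 1.
record IsPath {n : ℕ} (G : Graph n) (v u : Fin n) (P : List (Fin n)) : Set where
  field
    chain   : Chain (Adj G) P
    distinct : Unique P
    starts  : head P ≡ just v
    ends    : last P ≡ just u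

-- u is weakly (r,≺)-reachable from v: there is a path P from v to u of
-- length at most r (i.e. length P ≤ r + 1 vertices) all of whose vertices
-- other than u are greater than u.  (v ⪰ u follows since v ∈ P.)
WReach : {n : ℕ} → Graph n → LinOrder n → ℕ → Fin n → Fin n → Set
WReach {n} G ord r v u =
  Σ (List (Fin n)) λ P → IsPath G v u P × length P ≤ suc r ×
    All (λ x → x ≡ u ⊎ _≺_ ord u x) P

-- Cardinality phrased via duplicate-free lists:
-- "|S| ≤ b"  ⇔  every duplicate-free list of elements of S has length ≤ b
AtMost : {n : ℕ} → (Fin n → Set) → ℕ → Set
AtMost {n} S b = (xs : List (Fin n)) → Unique xs → All S xs → length xs ≤ b

-- "|S| ≥ m"  ⇔  some duplicate-free list of elements of S has length ≥ m
AtLeast : {n : ℕ} → (Fin n → Set) → ℕ → Set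
AtLeast {n} S m = Σ (List (Fin n)) λ xs → Unique xs × All S xs × length xs ≥ m

L : {n : ℕ} → Graph n → LinOrder n → ℕ → Fin n → Fin n → Set
L G ord r v u = WReach G ord r v u

R : {n : ℕ} → Graph n → LinOrder n → ℕ → Fin n → Fin n → Set
R G ord r u v = WReach G ord r v u

WcolAtMost : {n : ℕ} → Graph n → LinOrder n → ℕ → ℕ → Set
WcolAtMost G ord r b = ∀ v → AtMost (L G ord r v) b

Rich : {n : ℕ} → Graph n → LinOrder n → ℕ → ℕ → Subset n → Fin n → Set
Rich G ord r m O v = AtLeast (λ w → R G ord r v w × w ∈ O) m

{-# OPTIONS --safe #-}
-- Double counting the pairs (v , w) with v ∈ O' and w ∈ R(v) ∩ O: every rich v lies in at
-- least m of them, while for fixed w ∈ O the vertices v involved all lie in L(w), so there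
-- are at most b of them, and no pair has w ∉ O.
module Submission where

open import Defs
open import Data.Bool using (if_then_else_)
open import Data.Empty using (⊥-elim)
open import Data.Fin using (Fin; zero; suc)
open import Data.Fin.Properties using (_≟_)
open import Data.Fin.Subset using (Subset; _∈_; ∣_∣; inside; outside)
open import Data.Fin.Subset.Properties using (_∈?_)
open import Data.Vec using ([]; _∷_)
open import Data.List using (List; []; _∷_; length)
open import Data.List.Membership.Propositional using () renaming (_∈_ to _∈ₗ_)
open import Data.List.Relation.Unary.All using (All; []; _∷_)
import Data.List.Relation.Unary.All as All
open import Data.List.Relation.Unary.Any using (here; there; any?)
open import Data.List.Relation.Unary.AllPairs using ([]; _∷_)
open import Data.List.Relation.Unary.Unique.Propositional using (Unique)
open import Data.Nat using (ℕ; zero; suc; _+_; _*_; _≤_; z≤n)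
open import Data.Nat.Properties
  using (≤-refl; ≤-trans; ≤-reflexive; +-mono-≤; +-monoˡ-≤; m≤m+n; m≤n+m;
         *-zeroʳ; *-suc; *-identityʳ; *-distribˡ-+;
         +-commutativeSemigroup; +-0-commutativeMonoid; module ≤-Reasoning)
open import Data.Product using (_,_; proj₁; proj₂)
open import Function using (_∘_)
open import Relation.Nullary using (Dec; yes; no; does)
open import Relation.Nullary.Decidable using (dec-true)
open import Relation.Unary using (_⊆_)
open import Relation.Binary.PropositionalEquality using (_≡_; refl; cong; sym; module ≡-Reasoning)
open import Algebra.Properties.CommutativeSemigroup +-commutativeSemigroup using (interchange)
open import Algebra.Properties.CommutativeMonoid.Sum +-0-commutativeMonoid
  using (sum; sum-syntax; sum-cong-≗)

𝟙 : {P : Set} → Dec P → ℕ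
𝟙 P? = if does P? then 1 else 0

𝟙-yes : {P : Set} (P? : Dec P) → P → 𝟙 P? ≡ 1
𝟙-yes P? p = cong (if_then 1 else 0) (dec-true P? p)

infix 4 _∈ₗ?_
_∈ₗ?_ : ∀ {n} (w : Fin n) (xs : List (Fin n)) → Dec (w ∈ₗ xs)
w ∈ₗ? xs = any? (w ≟_) xs

sum-mono-≤ : ∀ {n} {f g : Fin n → ℕ} → (∀ i → f i ≤ g i) → sum f ≤ sum g
sum-mono-≤ {zero}  f≤g = z≤n
sum-mono-≤ {suc n} f≤g = +-mono-≤ (f≤g zero) (sum-mono-≤ (f≤g ∘ suc))

sum-distrib-+ : ∀ {n} (f g : Fin n → ℕ) → sum (λ i → f i + g i) ≡ sum f + sum g
sum-distrib-+ {zero}  f g = refl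
sum-distrib-+ {suc n} f g = begin
  (f zero + g zero) + sum (λ i → f (suc i) + g (suc i))
    ≡⟨ cong ((f zero + g zero) +_) (sum-distrib-+ (f ∘ suc) (g ∘ suc)) ⟩
  (f zero + g zero) + (sum (f ∘ suc) + sum (g ∘ suc))
    ≡⟨ interchange (f zero) (g zero) _ _ ⟩
  (f zero + sum (f ∘ suc)) + (g zero + sum (g ∘ suc)) ∎
  where open ≡-Reasoning

*-distribˡ-sum : ∀ {n} b (f : Fin n → ℕ) → b * sum f ≡ sum (λ i → b * f i)
*-distribˡ-sum {zero}  b f = *-zeroʳ b
*-distribˡ-sum {suc n} b f = begin
  b * (f zero + sum (f ∘ suc))       ≡⟨ *-distribˡ-+ b (f zero) _ ⟩
  b * f zero + b * sum (f ∘ suc)     ≡⟨ cong (b * f zero +_) (*-distribˡ-sum b (f ∘ suc)) ⟩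
  b * f zero + sum (λ i → b * f (suc i)) ∎
  where open ≡-Reasoning

term≤sum : ∀ {n} (f : Fin n → ℕ) i → f i ≤ sum f
term≤sum f zero    = m≤m+n _ _
term≤sum f (suc i) = ≤-trans (term≤sum (f ∘ suc) i) (m≤n+m _ _)

∣p∣≡∑∈ : ∀ {n} (p : Subset n) → ∣ p ∣ ≡ ∑[ w < n ] 𝟙 (w ∈? p)
∣p∣≡∑∈ []            = refl
∣p∣≡∑∈ (inside ∷ p)  = cong suc (∣p∣≡∑∈ p)
∣p∣≡∑∈ (outside ∷ p) = ∣p∣≡∑∈ p

length≤∑∈ : ∀ {n} {xs : List (Fin n)} → Unique xs → length xs ≤ ∑[ w < n ] 𝟙 (w ∈ₗ? xs)
length≤∑∈ []                               = z≤n
length≤∑∈ {n} {x ∷ xs} (x∉xs ∷ xs-unique) = begin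
  1 + length xs                                     ≡⟨ cong (_+ length xs) (𝟙-yes (x ≟ x) refl) ⟨
  𝟙 (x ≟ x) + length xs                             ≤⟨ +-mono-≤ (term≤sum (λ w → 𝟙 (w ≟ x)) x) (length≤∑∈ xs-unique) ⟩
  ∑[ w < n ] 𝟙 (w ≟ x) + ∑[ w < n ] 𝟙 (w ∈ₗ? xs)   ≡⟨ sum-distrib-+ (λ w → 𝟙 (w ≟ x)) _ ⟨
  ∑[ w < n ] (𝟙 (w ≟ x) + 𝟙 (w ∈ₗ? xs))            ≤⟨ sum-mono-≤ 𝟙-head+𝟙-tail≤𝟙 ⟩
  ∑[ w < n ] 𝟙 (w ∈ₗ? x ∷ xs)                       ∎
  where
  open ≤-Reasoning
  𝟙-head+𝟙-tail≤𝟙 : ∀ w → 𝟙 (w ≟ x) + 𝟙 (w ∈ₗ? xs) ≤ 𝟙 (w ∈ₗ? x ∷ xs)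
  𝟙-head+𝟙-tail≤𝟙 w with w ≟ x | w ∈ₗ? xs
  ... | yes refl | yes x∈xs = ⊥-elim (All.lookup x∉xs x∈xs refl)
  ... | yes _    | no _     = ≤-refl
  ... | no _     | _        = ≤-refl

AtMost-⊆ : ∀ {n} {P Q : Fin n → Set} {b} → P ⊆ Q → AtMost Q b → AtMost P b
AtMost-⊆ P⊆Q |Q|≤b xs xs-unique xs∈P = |Q|≤b xs xs-unique (All.map P⊆Q xs∈P)

module _ {n : ℕ} {Adj : Fin n → Fin n → Set} {m : ℕ} where

  Neighbourhoods : List (Fin n) → Set
  Neighbourhoods = All (λ x → AtLeast (Adj x) m)

  -- The x ∈ xs whose chosen neighbour list contains w; degrees are taken with respect to
  -- the chosen lists, which is what makes them at most b and zero outside O.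
  incident : Fin n → ∀ {xs} → Neighbourhoods xs → List (Fin n)
  incident w [] = []
  incident w {x ∷ xs} ((ys , _) ∷ Ns) with w ∈ₗ? ys
  ... | yes _ = x ∷ incident w Ns
  ... | no  _ = incident w Ns

  degree : Fin n → ∀ {xs} → Neighbourhoods xs → ℕ
  degree w Ns = length (incident w Ns)

  degree-∷ : ∀ w {x xs} (N@(ys , _) : AtLeast (Adj x) m) (Ns : Neighbourhoods xs) →
             degree w (N ∷ Ns) ≡ 𝟙 (w ∈ₗ? ys) + degree w Ns
  degree-∷ w (ys , _) Ns with w ∈ₗ? ys
  ... | yes _ = refl
  ... | no  _ = refl

  incident⊆ : ∀ w {xs} (Ns : Neighbourhoods xs) → All (_∈ₗ xs) (incident w Ns)
  incident⊆ w [] = []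
  incident⊆ w ((ys , _) ∷ Ns) with w ∈ₗ? ys
  ... | yes _ = here refl ∷ All.map there (incident⊆ w Ns)
  ... | no  _ = All.map there (incident⊆ w Ns)

  incident-unique : ∀ w {xs} (Ns : Neighbourhoods xs) → Unique xs → Unique (incident w Ns)
  incident-unique w [] [] = []
  incident-unique w ((ys , _) ∷ Ns) (x∉xs ∷ xs-unique) with w ∈ₗ? ys
  ... | yes _ = All.map (All.lookup x∉xs) (incident⊆ w Ns) ∷ incident-unique w Ns xs-unique
  ... | no  _ = incident-unique w Ns xs-unique

  incident-adj : ∀ w {xs} (Ns : Neighbourhoods xs) → All (λ x → Adj x w) (incident w Ns)
  incident-adj w [] = []
  incident-adj w ((ys , _ , ys⊆Adj , _) ∷ Ns) with w ∈ₗ? ys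
  ... | yes w∈ys = All.lookup ys⊆Adj w∈ys ∷ incident-adj w Ns
  ... | no  _    = incident-adj w Ns

  *-length≤∑degree : ∀ {xs} (Ns : Neighbourhoods xs) → m * length xs ≤ ∑[ w < n ] degree w Ns
  *-length≤∑degree [] = ≤-trans (≤-reflexive (*-zeroʳ m)) z≤n
  *-length≤∑degree {x ∷ xs} (N@(ys , ys-unique , _ , m≤|ys|) ∷ Ns) = begin
    m * suc (length xs)                                       ≡⟨ *-suc m (length xs) ⟩
    m + m * length xs                                         ≤⟨ +-mono-≤ m≤|ys| (*-length≤∑degree Ns) ⟩
    length ys + ∑[ w < n ] degree w Ns                        ≤⟨ +-monoˡ-≤ _ (length≤∑∈ ys-unique) ⟩
    ∑[ w < n ] 𝟙 (w ∈ₗ? ys) + ∑[ w < n ] degree w Ns          ≡⟨ sum-distrib-+ (λ w → 𝟙 (w ∈ₗ? ys)) _ ⟨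
    ∑[ w < n ] (𝟙 (w ∈ₗ? ys) + degree w Ns)                   ≡⟨ sum-cong-≗ (λ w → degree-∷ w N Ns) ⟨
    ∑[ w < n ] degree w (N ∷ Ns)                              ∎
    where open ≤-Reasoning

  degree≤ : ∀ {O : Subset n} {b xs} → (∀ {x w} → Adj x w → w ∈ O) →
            (∀ w → AtMost (λ x → Adj x w) b) → Unique xs → (Ns : Neighbourhoods xs) →
            ∀ w → degree w Ns ≤ b * 𝟙 (w ∈? O)
  degree≤ {O} {b} Adj⇒O |Adj-w|≤b xs-unique Ns w with w ∈? O
  ... | yes _ = ≤-trans (|Adj-w|≤b w _ (incident-unique w Ns xs-unique) (incident-adj w Ns))
                        (≤-reflexive (sym (*-identityʳ b)))
  ... | no w∉O with incident w Ns | incident-adj w Ns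
  ...   | []    | []          = z≤n
  ...   | _ ∷ _ | adj-x-w ∷ _ = ⊥-elim (w∉O (Adj⇒O adj-x-w))

double-counting : ∀ {n} {Adj : Fin n → Fin n → Set} {O : Subset n} {m b} {xs : List (Fin n)} →
                  (∀ {x w} → Adj x w → w ∈ O) → (∀ w → AtMost (λ x → Adj x w) b) →
                  Unique xs → All (λ x → AtLeast (Adj x) m) xs → m * length xs ≤ b * ∣ O ∣
double-counting {n} {O = O} {m} {b} {xs} Adj⇒O |Adj-w|≤b xs-unique Ns = begin
  m * length xs                  ≤⟨ *-length≤∑degree Ns ⟩
  ∑[ w < n ] degree w Ns         ≤⟨ sum-mono-≤ (degree≤ Adj⇒O |Adj-w|≤b xs-unique Ns) ⟩
  ∑[ w < n ] (b * 𝟙 (w ∈? O))    ≡⟨ *-distribˡ-sum b (λ w → 𝟙 (w ∈? O)) ⟨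
  b * (∑[ w < n ] 𝟙 (w ∈? O))    ≡⟨ cong (b *_) (∣p∣≡∑∈ O) ⟨
  b * ∣ O ∣                       ∎
  where open ≤-Reasoning

mainTheorem3 : {n : ℕ} (G : Graph n) (O : Subset n) (r m b : ℕ) (ord : LinOrder n) →
    1 ≤ m → WcolAtMost G ord r b →
    (O' : List (Fin n)) → Unique O' → All (Rich G ord r m O) O' →
    m * length O' ≤ b * ∣ O ∣
mainTheorem3 G O r m b ord _ wcol≤b O' O'-unique O'-rich =
  double-counting proj₂ (λ w → AtMost-⊆ proj₁ (wcol≤b w)) O'-unique O'-rich
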